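{- Let $\mathcal C$ and $\mathcal D$ be the affine plane curves over $\mathbb Q$ in the variables $(v,x)$ defined by \[8vx^3-8v^2x^2+4v^3x-v^4-16=0\quad\text{and}\quad 8vx^3+8v^2x^2+4v^3x+v^4+16=0,\] respectively. Then $\mathcal C(\mathbb Q)=\mathcal D(\mathbb Q)=\emptyset$. -}

module Defs where

open import Data.Nat using (ℕ)
open import Data.Integer using (+_)
open import Data.Rational using (ℚ; _+_; _*_; _-_; _/_)

cst : ℕ → ℚ
cst n = (+ n) / 1

Cpoly : ℚ → ℚ → ℚ
Cpoly v x = cst 8 * v * (x * x * x) - cst 8 * (v * v) * (x * x)
            + cst 4 * (v * v * v) * x - v * v * v * v - cst 16

Dpoly : ℚ → ℚ → ℚ
Dpoly v x = cst 8 * v * (x * x * x) + cst 8 * (v * v) * (x * x)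
            + cst 4 * (v * v * v) * x + v * v * v * v + cst 16

{-# OPTIONS --safe #-}
module Submission where

-- With Φ(b, c) = bc(b² + bc + c²), the substitution (b, c) = (v, 2x − v) turns the equation
-- of C into Φ(b, c) = 16, and x ↦ −x maps D onto C. Clearing denominators gives integers with
-- Φ(β, γ) = W⁴, W ≠ 0. Since Φ(b, −c) = 2(bc)² − Φ(b, c) ≤ 0 for natural b, c, the integers
-- β and γ have the same sign, and after dividing out their gcd the factors b, c and
-- b² + bc + c² of Φ(b, c) are pairwise coprime, hence fourth powers p⁴, q⁴, s⁴. But then
-- s⁴ + (pq)⁴ = (b + c)² = (p⁴ + q⁴)², contradicting Fermat's theorem that x⁴ + y⁴ = z² has
-- no solution in positive integers, which is proved by infinite descent through primitive
-- Pythagorean triples.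

open import Defs
open import Data.Product using (_×_; _,_)
open import Relation.Nullary using (¬_)
open import Relation.Binary.PropositionalEquality using (_≡_; sym; trans; cong)
open import Data.Rational using (ℚ; 0ℚ)
import Data.Rational.Base as ℚ
open import Data.Rational.Properties using (neg-injective)
open import Algebra.Bundles using (Semiring)
open import Algebra.Bundles.Raw using (RawSemiring)
import Algebra.Morphism.Definitions as Morphism

module CubicForm {a ℓ} (R : RawSemiring a ℓ) where
  open RawSemiring R

  Φ : Carrier → Carrier → Carrier
  Φ b c = b * c * (b * b + b * c + c * c)

module _ {a ℓ} (R : Semiring a ℓ) where
  open Semiring R
  open CubicForm rawSemiring

  Φ-cong : ∀ {b b′ c c′} → b ≈ b′ → c ≈ c′ → Φ b c ≈ Φ b′ c′
  Φ-cong b≈b′ c≈c′ =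
    *-cong (*-cong b≈b′ c≈c′)
           (+-cong (+-cong (*-cong b≈b′ b≈b′) (*-cong b≈b′ c≈c′)) (*-cong c≈c′ c≈c′))

module _ {a b ℓ₁ ℓ₂} (R₁ : RawSemiring a ℓ₁) (R₂ : Semiring b ℓ₂) where
  private
    module R₁ = RawSemiring R₁
    module R₂ = Semiring R₂
  open Morphism R₁.Carrier R₂.Carrier R₂._≈_ using (Homomorphic₂)

  Φ-homo : (f : R₁.Carrier → R₂.Carrier) →
           Homomorphic₂ f R₁._+_ R₂._+_ → Homomorphic₂ f R₁._*_ R₂._*_ →
           ∀ b c → f (CubicForm.Φ R₁ b c) R₂.≈ CubicForm.Φ R₂.rawSemiring (f b) (f c)
  Φ-homo f +-homo *-homo b c =
    R₂.trans (*-homo _ _) (R₂.*-cong (*-homo b c) (R₂.trans (+-homo _ _)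
      (R₂.+-cong (R₂.trans (+-homo _ _) (R₂.+-cong (*-homo b b) (*-homo b c))) (*-homo c c))))

module Naturals where
  open import Data.Nat.Base
  open import Data.Nat.Properties
  open import Data.Nat.Divisibility
  open import Data.Nat.DivMod using (_/_; m/n*n≡m)
  open import Data.Nat.GCD
    using (gcd; gcd[m,n]∣m; gcd[m,n]∣n; gcd[m,n]≢0; gcd-greatest; c*gcd[m,n]≡gcd[cm,cn])
  open import Data.Nat.Coprimality
    using (Coprime; coprime-divisor; coprime-/gcd) renaming (sym to coprime-sym)
  open import Data.Nat.Induction using (<-wellFounded)
  open import Data.Nat.Tactic.RingSolver using (solve-∀)
  open import Induction.WellFounded using (Acc; acc)
  open import Data.Product using (∃-syntax; _×_; _,_; proj₁; proj₂; map₂)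
  open import Data.Sum using (_⊎_; inj₁; inj₂)
  open import Function using (_∘_; it)
  open import Data.Empty using (⊥)
  open import Relation.Nullary using (¬_; contradiction)
  open import Relation.Binary.PropositionalEquality

  open CubicForm +-*-rawSemiring public

  private variable a b c d j t w : ℕ

  infixl 8 _²

  _² : ℕ → ℕ
  n ² = n * n

  nonZero-²⁻¹ : ∀ {n} → .{{NonZero (n ²)}} → NonZero n
  nonZero-²⁻¹ {n} = m*n≢0⇒m≢0 n

  ∣-² : ∀ {n} → d ∣ n → d ∣ n ²
  ∣-² {n = n} = ∣m⇒∣m*n n

  ²-cancel-≤ : ∀ {m n} → m ² ≤ n ² → m ≤ n
  ²-cancel-≤ m²≤n² = ≮⇒≥ (λ n<m → <⇒≱ (*-mono-< n<m n<m) m²≤n²)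

  ²-injective : ∀ {m n} → m ² ≡ n ² → m ≡ n
  ²-injective eq =
    ≤-antisym (²-cancel-≤ (≤-reflexive eq)) (²-cancel-≤ (≤-reflexive (sym eq)))

  ²-distrib-* : ∀ m n → (m * n) * (m * n) ≡ (m * m) * (n * n)
  ²-distrib-* = solve-∀

  coprime-∣ˡ : d ∣ a → Coprime a b → Coprime d b
  coprime-∣ˡ d∣a coprime (e∣d , e∣b) = coprime (∣-trans e∣d d∣a , e∣b)

  coprime-∣ʳ : d ∣ b → Coprime a b → Coprime a d
  coprime-∣ʳ d∣b coprime (e∣a , e∣d) = coprime (e∣a , ∣-trans e∣d d∣b)

  coprime-*ʳ : Coprime a b → Coprime a c → Coprime a (b * c)
  coprime-*ʳ a⊥b a⊥c (d∣a , d∣bc) = a⊥c (d∣a , coprime-divisor (coprime-∣ˡ d∣a a⊥b) d∣bc)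

  coprime-*ˡ : Coprime a c → Coprime b c → Coprime (a * b) c
  coprime-*ˡ a⊥c b⊥c = coprime-sym (coprime-*ʳ (coprime-sym a⊥c) (coprime-sym b⊥c))

  coprime-² : Coprime a b → Coprime (a ²) (b ²)
  coprime-² a⊥b = coprime-*ˡ a⊥b² a⊥b²
    where a⊥b² = coprime-*ʳ a⊥b a⊥b

  coprime-²⁻¹ : Coprime (a ²) (b ²) → Coprime a b
  coprime-²⁻¹ = coprime-∣ˡ (∣-² ∣-refl) ∘ coprime-∣ʳ (∣-² ∣-refl)

  -- For s = gcd a w: a divides gcd (w a) (w w) = w s, hence also gcd (s a) (s w) = s², while s²
  -- divides w² = b a and is coprime to b.
  coprime-*≡²⇒² : Coprime a b → a * b ≡ w ² → ∃[ s ] a ≡ s ²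
  coprime-*≡²⇒² {a} {b} {w} coprime ab≡w² = s , ∣-antisym a∣s² s²∣a
    where
    s = gcd a w
    a∣w² : a ∣ w ²
    a∣w² = subst (a ∣_) ab≡w² (m∣m*n b)
    a∣ws : a ∣ w * s
    a∣ws = subst (a ∣_) (sym (c*gcd[m,n]≡gcd[cm,cn] w a w)) (gcd-greatest (n∣m*n w) a∣w²)
    a∣s² : a ∣ s ²
    a∣s² = subst (a ∣_) (sym (c*gcd[m,n]≡gcd[cm,cn] s a w))
             (gcd-greatest (n∣m*n s) (subst (a ∣_) (*-comm w s) a∣ws))
    s²∣ba : s ² ∣ b * a
    s²∣ba = subst (s ² ∣_) (trans (sym ab≡w²) (*-comm a b))
              (*-pres-∣ (gcd[m,n]∣n a w) (gcd[m,n]∣n a w))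
    s²∣a : s ² ∣ a
    s²∣a = coprime-divisor (coprime-*ˡ s⊥b s⊥b) s²∣ba
      where s⊥b = coprime-∣ˡ (gcd[m,n]∣m a w) coprime

  coprime-*≡⁴⇒⁴ : Coprime a b → a * b ≡ w ² ² → ∃[ p ] a ≡ p ² ²
  coprime-*≡⁴⇒⁴ {a} {b} {w} coprime eq
    with coprime-*≡²⇒² {w = w ²} coprime eq
       | coprime-*≡²⇒² {w = w ²} (coprime-sym coprime) (trans (*-comm b a) eq)
  ... | α , refl | β , refl =
    map₂ (cong _²) (coprime-*≡²⇒² {α} {β} {w} (coprime-²⁻¹ coprime)
                                  (²-injective (trans (²-distrib-* α β) eq)))

  module _ {P : ℕ → ℕ}
           (coprime-*≡P⇒P : ∀ {a b w} → Coprime a b → a * b ≡ P w → ∃[ p ] a ≡ P p)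
           where

    pairwise-coprime-*≡P⇒P : Coprime a b → Coprime a c → Coprime b c → a * (b * c) ≡ P w →
                             (∃[ p ] a ≡ P p) × (∃[ q ] b ≡ P q) × (∃[ r ] c ≡ P r)
    pairwise-coprime-*≡P⇒P {a} {b} {c} {w} a⊥b a⊥c b⊥c abc≡Pw =
        coprime-*≡P⇒P {w = w} (coprime-*ʳ a⊥b a⊥c) abc≡Pw
      , coprime-*≡P⇒P {w = w} (coprime-*ʳ (coprime-sym a⊥b) b⊥c)
                              (trans (rotate₁ a b c) abc≡Pw)
      , coprime-*≡P⇒P {w = w} (coprime-*ʳ (coprime-sym a⊥c) (coprime-sym b⊥c))
                              (trans (rotate₂ a b c) abc≡Pw)
      where
      rotate₁ : ∀ a b c → b * (a * c) ≡ a * (b * c)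
      rotate₁ = solve-∀
      rotate₂ : ∀ a b c → c * (a * b) ≡ a * (b * c)
      rotate₂ = solve-∀

  record GcdFactorisation (m n : ℕ) : Set where
    field
      g m′ n′ : ℕ
      g≢0 : NonZero g
      coprime : Coprime m′ n′
      m≡m′g : m ≡ m′ * g
      n≡n′g : n ≡ n′ * g

  gcdFactorisation : ∀ m n .{{_ : NonZero m}} → GcdFactorisation m n
  gcdFactorisation m n = record
    { g = gcd m n
    ; m′ = m / gcd m n
    ; n′ = n / gcd m n
    ; g≢0 = gcd≢0
    ; coprime = coprime-/gcd m n
    ; m≡m′g = sym (m/n*n≡m (gcd[m,n]∣m m n))
    ; n≡n′g = sym (m/n*n≡m (gcd[m,n]∣n m n))
    }
    where instance
      gcd≢0 : NonZero (gcd m n)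
      gcd≢0 = ≢-nonZero (gcd[m,n]≢0 m n (inj₁ (≢-nonZero⁻¹ m)))

  m²∣n²⇒m∣n : ∀ {m n} .{{_ : NonZero m}} → m ² ∣ n ² → m ∣ n
  m²∣n²⇒m∣n {m} {n} m²∣n² = subst (_∣ n) (sym m≡g) (divides n′ n≡n′g)
    where
    open GcdFactorisation (gcdFactorisation m n)
    m′²∣n′² : m′ ² ∣ n′ ²
    m′²∣n′² = *-cancelʳ-∣ (g ²) {{m*n≢0 g g {{g≢0}} {{g≢0}}}}
                (subst₂ _∣_ (trans (cong _² m≡m′g) (²-distrib-* m′ g))
                            (trans (cong _² n≡n′g) (²-distrib-* n′ g)) m²∣n²)
    m′≡1 : m′ ≡ 1
    m′≡1 = m*n≡1⇒m≡1 m′ m′ (∣1⇒≡1 (coprime-divisor (coprime-² coprime)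
             (subst (m′ ² ∣_) (sym (*-identityʳ (n′ ²))) m′²∣n′²)))
    m≡g : m ≡ g
    m≡g = trans m≡m′g (trans (cong (_* g) m′≡1) (*-identityˡ g))

  Even Odd : ℕ → Set
  Even n = ∃[ k ] n ≡ 2 * k
  Odd n = ∃[ k ] n ≡ suc (2 * k)

  even-or-odd : ∀ n → Even n ⊎ Odd n
  even-or-odd zero = inj₁ (0 , refl)
  even-or-odd (suc n) with even-or-odd n
  ... | inj₁ (k , refl) = inj₂ (k , refl)
  ... | inj₂ (k , refl) = inj₁ (suc k , ring k)
    where
    ring : ∀ k → suc (suc (2 * k)) ≡ 2 * suc k
    ring = solve-∀

  even² : ∀ k → (2 * k) * (2 * k) ≡ 2 * (2 * (k * k))
  even² = solve-∀

  even-² : ∀ {n} → Even n → Even (n ²)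
  even-² (k , refl) = k * (2 * k) , *-assoc 2 k (2 * k)

  odd-² : ∀ {n} → Odd n → Odd (n ²)
  odd-² (k , refl) = 2 * k + 2 * (k * k) , ring k
    where
    ring : ∀ k → suc (2 * k) * suc (2 * k) ≡ suc (2 * (2 * k + 2 * (k * k)))
    ring = solve-∀

  even∧even⇒¬coprime : Even a → Even b → ¬ Coprime a b
  even∧even⇒¬coprime (i , refl) (j , refl) coprime =
    contradiction (coprime (m∣m*n {2} i , m∣m*n j)) λ ()

  -- Two odd squares sum to 2 modulo 4, which no square is.
  odd²+odd²≡2*odd : ∀ i j → suc (2 * i) * suc (2 * i) + suc (2 * j) * suc (2 * j)
                            ≡ 2 * suc (2 * (i + i * i + j + j * j))
  odd²+odd²≡2*odd = solve-∀

  odd²+odd²≢² : Odd a → Odd b → a ² + b ² ≢ c ²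
  odd²+odd²≢² {c = c} (i , refl) (j , refl) eq with even-or-odd c
  ... | inj₁ (k , refl) = even≢odd (k * k) (i + i * i + j + j * j)
    (sym (*-cancelˡ-≡ _ _ 2 (trans (sym (odd²+odd²≡2*odd i j)) (trans eq (even² k)))))
  ... | inj₂ o@(k , refl) = even≢odd (suc (2 * (i + i * i + j + j * j))) (2 * k + 2 * (k * k))
    (trans (sym (odd²+odd²≡2*odd i j)) (trans eq (proj₂ (odd-² o))))

  hypotenuse-difference-even : (2 * t) ² ≡ 2 * a * j + j ² →
                               ∃[ k ] j ≡ 2 * k × k * (a + k) ≡ t ²
  hypotenuse-difference-even {t} {a} {j} [2t]² with even-or-odd j
  ... | inj₂ (h , refl) = contradiction (trans (sym (even² t)) (trans [2t]² (ring a h)))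
                           (even≢odd (2 * (t * t)) (a * suc (2 * h) + 2 * h + 2 * (h * h)))
    where
    ring : ∀ a h → 2 * a * suc (2 * h) + suc (2 * h) * suc (2 * h)
                   ≡ suc (2 * (a * suc (2 * h) + 2 * h + 2 * (h * h)))
    ring = solve-∀
  ... | inj₁ (k , refl) =
    k , refl , *-cancelˡ-≡ _ _ 4 (trans (ring₁ a k) (trans (sym [2t]²) (ring₂ t)))
    where
    ring₁ : ∀ a k → 4 * (k * (a + k)) ≡ 2 * a * (2 * k) + (2 * k) * (2 * k)
    ring₁ = solve-∀
    ring₂ : ∀ t → (2 * t) * (2 * t) ≡ 4 * (t * t)
    ring₂ = solve-∀

  pythagorean-shift : a ² + (2 * t) ² ≡ c ² → ∃[ k ] c ≡ a + 2 * k × k * (a + k) ≡ t ²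
  pythagorean-shift {a} {t} {c} eq
    with c ∸ a | m+[n∸m]≡n {a} {c} (²-cancel-≤ (subst (a ² ≤_) eq (m≤m+n (a ²) _)))
  ... | j | refl
    with hypotenuse-difference-even {t} {a} {j} (+-cancelˡ-≡ (a ²) _ _ (trans eq (ring a j)))
    where
    ring : ∀ a j → (a + j) * (a + j) ≡ a * a + (2 * a * j + j * j)
    ring = solve-∀
  ... | k , refl , k[a+k]≡t² = k , refl , k[a+k]≡t²

  -- The first leg is a = m² − n², stated additively to avoid truncated subtraction.
  record PythagoreanParametrisation (a b c : ℕ) : Set where
    field
      m n : ℕ
      coprime : Coprime m n
      a+n²≡m² : a + n ² ≡ m ²
      b≡2mn : b ≡ 2 * (m * n)
      c≡m²+n² : c ≡ m ² + n ²

  primitive-pythagorean : Coprime a b → Even b → a ² + b ² ≡ c ² →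
                          PythagoreanParametrisation a b c
  primitive-pythagorean {a} {c = c} coprime (t , refl) eq with pythagorean-shift {a} {t} {c} eq
  ... | k , refl , k[a+k]≡t² = record
    { m = m ; n = n ; coprime = m⊥n
    ; a+n²≡m² = a+n²≡m²
    ; b≡2mn = cong (2 *_) t≡mn
    ; c≡m²+n² = trans (ring a k) (cong₂ _+_ a+k≡m² k≡n²)
    }
    where
    ring : ∀ a k → a + 2 * k ≡ (a + k) + k
    ring = solve-∀
    a⊥t : Coprime a t
    a⊥t = coprime-∣ʳ (n∣m*n 2) coprime
    k⊥a+k : Coprime k (a + k)
    k⊥a+k {d} (d∣k , d∣a+k) = coprime-*ʳ a⊥t a⊥t
      ( ∣m+n∣m⇒∣n (subst (d ∣_) (+-comm a k) d∣a+k) d∣k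
      , subst (d ∣_) k[a+k]≡t² (∣m⇒∣m*n (a + k) d∣k))
    k-square : ∃[ n ] k ≡ n ²
    k-square = coprime-*≡²⇒² {w = t} k⊥a+k k[a+k]≡t²
    a+k-square : ∃[ m ] a + k ≡ m ²
    a+k-square =
      coprime-*≡²⇒² {w = t} (coprime-sym k⊥a+k) (trans (*-comm (a + k) k) k[a+k]≡t²)
    n = proj₁ k-square
    k≡n² = proj₂ k-square
    m = proj₁ a+k-square
    a+k≡m² = proj₂ a+k-square
    a+n²≡m² : a + n ² ≡ m ²
    a+n²≡m² = trans (cong (a +_) (sym k≡n²)) a+k≡m²
    t≡mn : t ≡ m * n
    t≡mn = ²-injective (trans (sym k[a+k]≡t²) (trans (cong₂ _*_ k≡n² a+k≡m²)
                                                (trans (*-comm (n ²) (m ²)) (sym (²-distrib-* m n)))))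
    m⊥n : Coprime m n
    m⊥n {d} (d∣m , d∣n) = a⊥t
      ( ∣m+n∣m⇒∣n (subst (d ∣_) (sym (trans (+-comm (n ²) a) a+n²≡m²)) (∣-² d∣m)) (∣-² d∣n)
      , subst (d ∣_) (sym t≡mn) (∣m⇒∣m*n n d∣m))

  r²+s²-coprime : ∀ {r s} → Coprime r s → Coprime (r ² + s ²) r
  r²+s²-coprime {r} r⊥s {d} (d∣r²+s² , d∣r) =
    coprime-*ʳ r⊥s r⊥s (d∣r , ∣m+n∣m⇒∣n d∣r²+s² (∣-² d∣r))

  n≤n² : ∀ n → n ≤ n ²
  n≤n² zero = z≤n
  n≤n² n@(suc _) = m≤m*n n n

  FermatQuarticFree : ℕ → Set
  FermatQuarticFree z =
    ∀ {x y} .{{_ : NonZero x}} .{{_ : NonZero y}} → Coprime x y → x ² ² + y ² ² ≢ z ²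

  -- r, s and r² + s² are pairwise coprime, so all three are squares x₁², y₁², z₁².
  r²+s²-descent : ∀ {r s w} .{{_ : NonZero (r * s)}} → Coprime r s → (r ² + s ²) * (r * s) ≡ w ² →
                  ∃[ z₁ ] r ² + s ² ≡ z₁ ² × ¬ FermatQuarticFree z₁
  r²+s²-descent {r} {s} {w} r⊥s [r²+s²]rs≡w²
    with pairwise-coprime-*≡P⇒P (λ {a b w} → coprime-*≡²⇒² {a} {b} {w}) {w = w}
           (r²+s²-coprime r⊥s)
           (subst (λ m → Coprime m s) (+-comm (s ²) (r ²)) (r²+s²-coprime (coprime-sym r⊥s)))
           r⊥s [r²+s²]rs≡w²
  ... | (z₁ , r²+s²≡z₁²) , (x₁ , refl) , (y₁ , refl) = z₁ , r²+s²≡z₁² , λ free →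
    free {x₁} {y₁} {{x₁≢0}} {{y₁≢0}} (coprime-²⁻¹ r⊥s) r²+s²≡z₁²
    where
    x₁≢0 : NonZero x₁
    x₁≢0 = nonZero-²⁻¹ {{m*n≢0⇒m≢0 (x₁ ²)}}
    y₁≢0 : NonZero y₁
    y₁≢0 = nonZero-²⁻¹ {{m*n≢0⇒n≢0 (x₁ ²)}}

  -- Parametrising (x², y², z) and then (x, n, m) yields y² = 4 m r s with m = r² + s² and r ⊥ s,
  -- and m is the square of some z₁ < z.
  fermat-descent : ∀ {x y z} → (∀ {c} → c < z → FermatQuarticFree c) → .{{NonZero y}} →
                   Coprime x y → Odd x → Even y → x ² ² + y ² ² ≢ z ²
  fermat-descent {x} {_} {z} IH x⊥y x-odd (y′ , refl) eq =
    smaller-solution (r²+s²-descent {r} {s} {y′} {{rs≢0}} r⊥s [r²+s²]rs≡y′²)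
    where
    open PythagoreanParametrisation
      (primitive-pythagorean {c = z} (coprime-² x⊥y) (even-² (y′ , refl)) eq)
    n-even : Even n
    n-even with even-or-odd n
    ... | inj₁ even = even
    ... | inj₂ n-odd = contradiction a+n²≡m² (odd²+odd²≢² {c = m} x-odd n-odd)
    x⊥n : Coprime x n
    x⊥n {d} (d∣x , d∣n) =
      coprime-*ˡ coprime coprime
        (subst (d ∣_) a+n²≡m² (∣m∣n⇒∣m+n (∣-² d∣x) (∣-² d∣n)) , d∣n)
    open PythagoreanParametrisation (primitive-pythagorean {c = m} x⊥n n-even a+n²≡m²)
      renaming (m to r; n to s; coprime to r⊥s; b≡2mn to n≡2rs; c≡m²+n² to m≡r²+s²)
      using ()
    ring₁ : ∀ y′ → 4 * (y′ * y′) ≡ (2 * y′) * (2 * y′)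
    ring₁ = solve-∀
    ring₂ : ∀ m r s → 2 * (m * (2 * (r * s))) ≡ 4 * (m * (r * s))
    ring₂ = solve-∀
    [r²+s²]rs≡y′² : (r ² + s ²) * (r * s) ≡ y′ ²
    [r²+s²]rs≡y′² = sym (*-cancelˡ-≡ _ _ 4 (begin
      4 * y′ ²                 ≡⟨ ring₁ y′ ⟩
      (2 * y′) ²               ≡⟨ b≡2mn ⟩
      2 * (m * n)              ≡⟨ cong (λ n → 2 * (m * n)) n≡2rs ⟩
      2 * (m * (2 * (r * s)))  ≡⟨ ring₂ m r s ⟩
      4 * (m * (r * s))        ≡⟨ cong (λ m → 4 * (m * (r * s))) m≡r²+s² ⟩
      4 * ((r ² + s ²) * (r * s)) ∎))
      where open ≡-Reasoning
    instance
      n≢0 : NonZero n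
      n≢0 = m*n≢0⇒n≢0 m
              {{m*n≢0⇒n≢0 2 {{subst NonZero b≡2mn (m*n≢0 (2 * y′) (2 * y′))}}}}
    rs≢0 : NonZero (r * s)
    rs≢0 = m*n≢0⇒n≢0 2 {{subst NonZero n≡2rs n≢0}}
    smaller-solution : ∃[ z₁ ] r ² + s ² ≡ z₁ ² × ¬ FermatQuarticFree z₁ → ⊥
    smaller-solution (z₁ , r²+s²≡z₁² , ¬free) = ¬free (IH z₁<z)
      where
      z₁<z : z₁ < z
      z₁<z = begin-strict
        z₁          ≤⟨ n≤n² z₁ ⟩
        z₁ ²        ≡⟨ sym r²+s²≡z₁² ⟩
        r ² + s ²   ≡⟨ sym m≡r²+s² ⟩
        m           ≤⟨ n≤n² m ⟩
        m ²         <⟨ m<m+n (m ²) (>-nonZero⁻¹ (n ²) {{m*n≢0 n n}}) ⟩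
        m ² + n ²   ≡⟨ sym c≡m²+n² ⟩
        z           ∎
        where open ≤-Reasoning

  fermat-acc : ∀ {z} → Acc _<_ z → FermatQuarticFree z
  fermat-acc {z} (acc rs) {x} {y} x⊥y with even-or-odd x | even-or-odd y
  ... | inj₁ x-even | inj₁ y-even = λ _ → even∧even⇒¬coprime x-even y-even x⊥y
  ... | inj₂ x-odd | inj₂ y-odd = odd²+odd²≢² {c = z} (odd-² x-odd) (odd-² y-odd)
  ... | inj₂ x-odd | inj₁ y-even = fermat-descent (fermat-acc ∘ rs) x⊥y x-odd y-even
  ... | inj₁ x-even | inj₂ y-odd =
    fermat-descent (fermat-acc ∘ rs) (coprime-sym x⊥y) y-odd x-even
      ∘ trans (+-comm (y ² ²) (x ² ²))

  x⁴+y⁴≢z² : ∀ z → FermatQuarticFree z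
  x⁴+y⁴≢z² z = fermat-acc (<-wellFounded z)

  b²+bc+c²-coprime : Coprime b c → Coprime b (b ² + b * c + c ²) × Coprime c (b ² + b * c + c ²)
  b²+bc+c²-coprime {b} {c} b⊥c = b⊥Q , c⊥Q
    where
    rearrange : ∀ b c → b * b + b * c + c * c ≡ (b * c + c * c) + b * b
    rearrange = solve-∀
    b⊥Q : Coprime b (b ² + b * c + c ²)
    b⊥Q {d} (d∣b , d∣Q) =
      coprime-*ʳ b⊥c b⊥c
        (d∣b , ∣m+n∣m⇒∣n d∣Q (∣m∣n⇒∣m+n (∣-² d∣b) (∣m⇒∣m*n c d∣b)))
    c⊥Q : Coprime c (b ² + b * c + c ²)
    c⊥Q {d} (d∣c , d∣Q) = coprime-*ʳ (coprime-sym b⊥c) (coprime-sym b⊥c)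
      (d∣c , ∣m+n∣m⇒∣n (subst (d ∣_) (rearrange b c) d∣Q)
                       (∣m∣n⇒∣m+n (∣n⇒∣m*n b d∣c) (∣-² d∣c)))

  -- b, c and b² + bc + c² are pairwise coprime, hence fourth powers p⁴, q⁴, s⁴, and then
  -- s⁴ + (pq)⁴ = (b² + bc + c²) + bc = (p⁴ + q⁴)².
  coprime⇒Φ≢⁴ : .{{NonZero b}} → .{{NonZero c}} → Coprime b c → Φ b c ≢ w ² ²
  coprime⇒Φ≢⁴ {b} {c} {w} b⊥c Φ≡w⁴ =
    x⁴+y⁴≢z² (p ² ² + q ² ²) {{s≢0}} {{pq≢0}} s⊥pq s⁴+[pq]⁴≡[p⁴+q⁴]²
    where
    Q = b ² + b * c + c ²
    b⊥Q = proj₁ (b²+bc+c²-coprime b⊥c)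
    c⊥Q = proj₂ (b²+bc+c²-coprime b⊥c)
    fourth-powers = pairwise-coprime-*≡P⇒P (λ {a b w} → coprime-*≡⁴⇒⁴ {a} {b} {w}) {w = w}
                      b⊥c b⊥Q c⊥Q (trans (sym (*-assoc b c Q)) Φ≡w⁴)
    p = proj₁ (proj₁ fourth-powers)
    q = proj₁ (proj₁ (proj₂ fourth-powers))
    s = proj₁ (proj₂ (proj₂ fourth-powers))
    b≡p⁴ = proj₂ (proj₁ fourth-powers)
    c≡q⁴ = proj₂ (proj₁ (proj₂ fourth-powers))
    Q≡s⁴ = proj₂ (proj₂ (proj₂ fourth-powers))
    ring₁ : ∀ p q → (p * q) * (p * q) * ((p * q) * (p * q))
                    ≡ (p * p) * (p * p) * ((q * q) * (q * q))
    ring₁ = solve-∀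
    ring₂ : ∀ b c → b * b + b * c + c * c + b * c ≡ (b + c) * (b + c)
    ring₂ = solve-∀
    [pq]⁴≡bc : (p * q) ² ² ≡ b * c
    [pq]⁴≡bc = trans (ring₁ p q) (sym (cong₂ _*_ b≡p⁴ c≡q⁴))
    s⁴+[pq]⁴≡[p⁴+q⁴]² : s ² ² + (p * q) ² ² ≡ (p ² ² + q ² ²) ²
    s⁴+[pq]⁴≡[p⁴+q⁴]² = begin
      s ² ² + (p * q) ² ²  ≡⟨ cong₂ _+_ (sym Q≡s⁴) [pq]⁴≡bc ⟩
      Q + b * c            ≡⟨ ring₂ b c ⟩
      (b + c) ²            ≡⟨ cong _² (cong₂ _+_ b≡p⁴ c≡q⁴) ⟩
      (p ² ² + q ² ²) ²    ∎
      where open ≡-Reasoning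
    s⊥pq : Coprime s (p * q)
    s⊥pq = coprime-∣ˡ (subst (s ∣_) (sym Q≡s⁴) (∣-² (∣-² ∣-refl)))
             (coprime-∣ʳ (subst (p * q ∣_) [pq]⁴≡bc (∣-² (∣-² ∣-refl)))
               (coprime-sym (coprime-*ˡ b⊥Q c⊥Q)))
    Q≢0 : NonZero Q
    Q≢0 = ≢-nonZero (≢-nonZero⁻¹ (b ²) {{m*n≢0 b b}}
                     ∘ m+n≡0⇒m≡0 (b ²) ∘ m+n≡0⇒m≡0 (b ² + b * c))
    s≢0 : NonZero s
    s≢0 = nonZero-²⁻¹ {{nonZero-²⁻¹ {{subst NonZero Q≡s⁴ Q≢0}}}}
    pq≢0 : NonZero (p * q)
    pq≢0 = m*n≢0 p q {{nonZero-²⁻¹ {{nonZero-²⁻¹ {{subst NonZero b≡p⁴ it}}}}}}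
                     {{nonZero-²⁻¹ {{nonZero-²⁻¹ {{subst NonZero c≡q⁴ it}}}}}}

  Φ-homogeneous : ∀ b c g → Φ (b * g) (c * g) ≡ g ² ² * Φ b c
  Φ-homogeneous = ring
    where
    ring : ∀ b c g → (b * g) * (c * g) * ((b * g) * (b * g) + (b * g) * (c * g) + (c * g) * (c * g))
                     ≡ (g * g) * (g * g) * (b * c * (b * b + b * c + c * c))
    ring = solve-∀

  Φ≢⁴ : .{{NonZero b}} → .{{NonZero c}} → Φ b c ≢ w ² ²
  Φ≢⁴ {b} {c} {w} Φ≡w⁴ =
    coprime⇒Φ≢⁴ {b′} {c′} {w′} {{b′≢0}} {{c′≢0}} coprime
      (*-cancelˡ-≡ _ _ (g ² ²) g⁴Φ′≡g⁴w′⁴)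
    where
    open GcdFactorisation (gcdFactorisation b c)
      renaming (m′ to b′; n′ to c′; m≡m′g to b≡b′g; n≡n′g to c≡c′g)
    instance
      _ = g≢0
      g²≢0 : NonZero (g ²)
      g²≢0 = m*n≢0 g g
      g⁴≢0 : NonZero (g ² ²)
      g⁴≢0 = m*n≢0 (g ²) (g ²)
    g⁴Φ′≡w⁴ : g ² ² * Φ b′ c′ ≡ w ² ²
    g⁴Φ′≡w⁴ =
      trans (sym (Φ-homogeneous b′ c′ g)) (trans (cong₂ Φ (sym b≡b′g) (sym c≡c′g)) Φ≡w⁴)
    g∣w : g ∣ w
    g∣w = m²∣n²⇒m∣n (m²∣n²⇒m∣n
            (divides (Φ b′ c′) (trans (sym g⁴Φ′≡w⁴) (*-comm (g ² ²) (Φ b′ c′)))))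
    w′ = quotient g∣w
    ring : ∀ w′ g → (w′ * g) * (w′ * g) * ((w′ * g) * (w′ * g))
                    ≡ (g * g) * (g * g) * ((w′ * w′) * (w′ * w′))
    ring = solve-∀
    g⁴Φ′≡g⁴w′⁴ : g ² ² * Φ b′ c′ ≡ g ² ² * w′ ² ²
    g⁴Φ′≡g⁴w′⁴ =
      trans g⁴Φ′≡w⁴ (trans (cong (λ w → w ² ²) (_∣_.equality g∣w)) (ring w′ g))
    b′≢0 : NonZero b′
    b′≢0 = m*n≢0⇒m≢0 b′ {{subst NonZero b≡b′g it}}
    c′≢0 : NonZero c′
    c′≢0 = m*n≢0⇒m≢0 c′ {{subst NonZero c≡c′g it}}

  bc≤b²+c² : ∀ b c → b * c ≤ b ² + c ²
  bc≤b²+c² b c with ≤-total b c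
  ... | inj₁ b≤c = ≤-trans (*-monoˡ-≤ c b≤c) (m≤n+m (c ²) (b ²))
  ... | inj₂ c≤b = ≤-trans (*-monoʳ-≤ b c≤b) (m≤m+n (b ²) (c ²))

  2[bc]²≤Φ : ∀ b c → 2 * (b * c) ² ≤ Φ b c
  2[bc]²≤Φ b c = begin
    2 * (b * c) ²                ≡⟨ ring₁ b c ⟩
    b * c * (b * c + b * c)      ≤⟨ *-monoʳ-≤ (b * c) (+-monoˡ-≤ (b * c) (bc≤b²+c² b c)) ⟩
    b * c * (b ² + c ² + b * c)  ≡⟨ ring₂ b c ⟩
    Φ b c                        ∎
    where
    open ≤-Reasoning
    ring₁ : ∀ b c → 2 * ((b * c) * (b * c)) ≡ b * c * (b * c + b * c)
    ring₁ = solve-∀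
    ring₂ : ∀ b c → b * c * (b * b + c * c + b * c) ≡ b * c * (b * b + b * c + c * c)
    ring₂ = solve-∀

module Integers where
  open import Data.Nat.Base as ℕ using (ℕ; suc)
  import Data.Nat.Properties as ℕ
  open import Data.Integer.Base hiding (suc)
  open import Data.Integer.Properties using (+-*-semiring; pos-+; pos-*; +-injective)
  open import Data.Integer.Tactic.RingSolver using (solve-∀)
  open import Relation.Binary.PropositionalEquality
  open Naturals using (_²; 2[bc]²≤Φ) renaming (Φ to Φℕ; Φ≢⁴ to Φℕ≢⁴)
  open CubicForm +-*-rawSemiring public

  pos-Φ : ∀ b c → + Φℕ b c ≡ Φ (+ b) (+ c)
  pos-Φ = Φ-homo ℕ.+-*-rawSemiring +-*-semiring +_ pos-+ pos-*

  i*i≡+∣i∣² : ∀ i → i * i ≡ + (∣ i ∣ ²)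
  i*i≡+∣i∣² (+ n) = sym (pos-* n n)
  i*i≡+∣i∣² -[1+ n ] = refl

  Φ-comm : ∀ x y → Φ y x ≡ Φ x y
  Φ-comm = ring
    where
    ring : ∀ x y → y * x * (y * y + y * x + x * x) ≡ x * y * (x * x + x * y + y * y)
    ring = solve-∀

  Φ-neg : ∀ x y → Φ (- x) (- y) ≡ Φ x y
  Φ-neg = ring
    where
    ring : ∀ x y → (- x) * (- y) * ((- x) * (- x) + (- x) * (- y) + (- y) * (- y))
                   ≡ x * y * (x * x + x * y + y * y)
    ring = solve-∀

  Φ[x,-y]+Φ[x,y]≡2[xy]² : ∀ x y → Φ x (- y) + Φ x y ≡ + 2 * ((x * y) * (x * y))
  Φ[x,-y]+Φ[x,y]≡2[xy]² = ring
    where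
    ring : ∀ x y → x * (- y) * (x * x + x * (- y) + (- y) * (- y)) + x * y * (x * x + x * y + y * y)
                   ≡ + 2 * ((x * y) * (x * y))
    ring = solve-∀

  pos-2[bc]² : ∀ b c → + (2 ℕ.* (b ℕ.* c) ²) ≡ + 2 * ((+ b * + c) * (+ b * + c))
  pos-2[bc]² b c = begin
    + (2 ℕ.* (b ℕ.* c) ²)               ≡⟨ pos-* 2 ((b ℕ.* c) ²) ⟩
    + 2 * + ((b ℕ.* c) ²)               ≡⟨ cong (+ 2 *_) (pos-* (b ℕ.* c) (b ℕ.* c)) ⟩
    + 2 * (+ (b ℕ.* c) * + (b ℕ.* c))   ≡⟨ cong (λ i → + 2 * (i * i)) (pos-* b c) ⟩
    + 2 * ((+ b * + c) * (+ b * + c))   ∎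
    where open ≡-Reasoning

  -- Φ(b, −c) = 2(bc)² − Φ(b, c) ≤ 0.
  Φ[b,-c]≢+⁴ : ∀ b c {n} → .{{ℕ.NonZero n}} → Φ (+ b) (- + c) ≢ + (n ² ²)
  Φ[b,-c]≢+⁴ b c {n} eq = ℕ.<-irrefl refl (begin-strict
    Φℕ b c              <⟨ ℕ.m<n+m (Φℕ b c) (ℕ.>-nonZero⁻¹ (n ² ²) {{n⁴≢0}}) ⟩
    n ² ² ℕ.+ Φℕ b c    ≡⟨ +-injective n⁴+Φ≡2[bc]² ⟩
    2 ℕ.* (b ℕ.* c) ²   ≤⟨ 2[bc]²≤Φ b c ⟩
    Φℕ b c              ∎)
    where
    open ℕ.≤-Reasoning
    n⁴≢0 = ℕ.m*n≢0 (n ²) (n ²) {{ℕ.m*n≢0 n n}} {{ℕ.m*n≢0 n n}}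
    n⁴+Φ≡2[bc]² : + (n ² ² ℕ.+ Φℕ b c) ≡ + (2 ℕ.* (b ℕ.* c) ²)
    n⁴+Φ≡2[bc]² = trans (pos-+ (n ² ²) (Φℕ b c)) (trans (cong₂ _+_ (sym eq) (pos-Φ b c))
                    (trans (Φ[x,-y]+Φ[x,y]≡2[xy]² (+ b) (+ c)) (sym (pos-2[bc]² b c))))

  Φ≢+⁴ : ∀ β γ {n} → .{{ℕ.NonZero n}} → Φ β γ ≢ + (n ² ²)
  Φ≢+⁴ (+ 0) γ {n} eq = ℕ.≢-nonZero⁻¹ (n ² ²) {{n⁴≢0}} (sym (+-injective eq))
    where n⁴≢0 = ℕ.m*n≢0 (n ²) (n ²) {{ℕ.m*n≢0 n n}} {{ℕ.m*n≢0 n n}}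
  Φ≢+⁴ β (+ 0) eq = Φ≢+⁴ (+ 0) β (trans (Φ-comm β (+ 0)) eq)
  Φ≢+⁴ +[1+ b ] +[1+ c ] {n} eq =
    Φℕ≢⁴ {suc b} {suc c} {n} (+-injective (trans (pos-Φ (suc b) (suc c)) eq))
  Φ≢+⁴ -[1+ b ] -[1+ c ] eq = Φ≢+⁴ +[1+ b ] +[1+ c ] (trans (sym (Φ-neg +[1+ b ] +[1+ c ])) eq)
  Φ≢+⁴ +[1+ b ] -[1+ c ] eq = Φ[b,-c]≢+⁴ (suc b) (suc c) eq
  Φ≢+⁴ -[1+ b ] +[1+ c ] eq = Φ[b,-c]≢+⁴ (suc c) (suc b) (trans (Φ-comm -[1+ b ] +[1+ c ]) eq)

  Φ≢⁴ : ∀ β γ w → .{{NonZero w}} → Φ β γ ≢ w * w * (w * w)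
  Φ≢⁴ β γ w eq = Φ≢+⁴ β γ {∣ w ∣} (begin
    Φ β γ                        ≡⟨ eq ⟩
    w * w * (w * w)              ≡⟨ cong₂ _*_ (i*i≡+∣i∣² w) (i*i≡+∣i∣² w) ⟩
    + (∣ w ∣ ²) * + (∣ w ∣ ²)    ≡⟨ pos-* (∣ w ∣ ²) (∣ w ∣ ²) ⟨
    + (∣ w ∣ ² ²)                ∎)
    where open ≡-Reasoning

module UnnormalisedRationals where
  open import Data.Nat.Base using (suc)
  import Data.Nat.Properties as ℕ
  open import Data.Integer.Base as ℤ using (ℤ; +_)
  import Data.Integer.Properties as ℤ
  open import Data.Integer.Tactic.RingSolver using (solve-∀)
  open import Data.Rational.Unnormalised.Base
  open import Data.Rational.Unnormalised.Properties
    using (≃-refl; ≃-sym; *-cong; *-assoc; +-*-commutativeRing; drop-*≡*; module ≃-Reasoning)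
  open import Data.Rational.Unnormalised.Solver using (module +-*-Solver)
  open import Algebra.Bundles using (CommutativeRing)
  open import Relation.Binary.PropositionalEquality
  open CubicForm +-*-rawSemiring public
  open Integers using () renaming (Φ to Φℤ)

  /1-+ : ∀ i j → (i ℤ.+ j) / 1 ≃ i / 1 + j / 1
  /1-+ i j = *≡* (ring i j)
    where
    ring : ∀ i j → (i ℤ.+ j) ℤ.* + 1 ≡ (i ℤ.* + 1 ℤ.+ j ℤ.* + 1) ℤ.* + 1
    ring = solve-∀

  /1-* : ∀ i j → (i ℤ.* j) / 1 ≃ (i / 1) * (j / 1)
  /1-* i j = ≃-refl

  /1-injective : ∀ {i j} → i / 1 ≃ j / 1 → i ≡ j
  /1-injective {i} {j} eq = trans (sym (ℤ.*-identityʳ i)) (trans (drop-*≡* eq) (ℤ.*-identityʳ j))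

  p*↧p≃↥p : ∀ p → p * (↧ p / 1) ≃ ↥ p / 1
  p*↧p≃↥p (mkℚᵘ n d) =
    *≡* (trans (ℤ.*-identityʳ (n ℤ.* + suc d)) (cong (λ k → n ℤ.* + suc k) (sym (ℕ.*-identityʳ d))))

  p*[↧p*i]≃↥p*i : ∀ p i → p * ((↧ p ℤ.* i) / 1) ≃ (↥ p ℤ.* i) / 1
  p*[↧p*i]≃↥p*i p i = begin
    p * ((↧ p / 1) * (i / 1))  ≈⟨ ≃-sym (*-assoc p (↧ p / 1) (i / 1)) ⟩
    (p * (↧ p / 1)) * (i / 1)  ≈⟨ *-cong (p*↧p≃↥p p) ≃-refl ⟩
    (↥ p / 1) * (i / 1)        ∎
    where open ≃-Reasoning

  Φ-homogeneous : ∀ u w t → Φ (u * t) (w * t) ≃ Φ u w * (t * t * (t * t))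
  Φ-homogeneous = solve 3 (λ u w t →
    (u :* t) :* (w :* t) :* ((u :* t) :* (u :* t) :+ (u :* t) :* (w :* t) :+ (w :* t) :* (w :* t))
    := u :* w :* (u :* u :+ u :* w :+ w :* w) :* (t :* t :* (t :* t))) ≃-refl
    where open +-*-Solver

  -- Multiplying u and w by the product N of their denominators makes them integers.
  Φ≃16⇒Φℤ≡16N⁴ : ∀ u w → Φ u w ≃ + 16 / 1 →
                  let N = ↧ u ℤ.* ↧ w
                  in Φℤ (↥ u ℤ.* ↧ w) (↥ w ℤ.* ↧ u) ≡ + 16 ℤ.* (N ℤ.* N ℤ.* (N ℤ.* N))
  Φ≃16⇒Φℤ≡16N⁴ u w Φ≃16 = /1-injective (begin
    Φℤ β γ / 1                    ≈⟨ Φ-homo ℤ.+-*-rawSemiring semiring (_/ 1) /1-+ /1-* β γ ⟩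
    Φ (β / 1) (γ / 1)             ≈⟨ Φ-cong semiring β≃u*t γ≃w*t ⟩
    Φ (u * t) (w * t)             ≈⟨ Φ-homogeneous u w t ⟩
    Φ u w * (t * t * (t * t))     ≈⟨ *-cong Φ≃16 ≃-refl ⟩
    + 16 / 1 * (t * t * (t * t))  ∎)
    where
    open ≃-Reasoning
    open CommutativeRing +-*-commutativeRing using (semiring)
    β = ↥ u ℤ.* ↧ w
    γ = ↥ w ℤ.* ↧ u
    t = (↧ u ℤ.* ↧ w) / 1
    β≃u*t : β / 1 ≃ u * t
    β≃u*t = ≃-sym (p*[↧p*i]≃↥p*i u (↧ w))
    γ≃w*t : γ / 1 ≃ w * t
    γ≃w*t = begin
      γ / 1                    ≈⟨ p*[↧p*i]≃↥p*i w (↧ u) ⟨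
      w * ((↧ w ℤ.* ↧ u) / 1)  ≡⟨ cong (λ i → w * (i / 1)) (ℤ.*-comm (↧ w) (↧ u)) ⟩
      w * t                    ∎

module Rationals where
  open import Data.Integer.Base as ℤ using (+_)
  open import Data.Integer.Tactic.RingSolver using (solve-∀)
  open import Data.Rational.Base
  open import Data.Rational.Properties using (toℚᵘ-homo-+; toℚᵘ-homo-*; toℚᵘ-cong)
  open import Data.Rational.Solver using (module +-*-Solver)
  import Data.Rational.Unnormalised.Base as ℚᵘ
  import Data.Rational.Unnormalised.Properties as ℚᵘ
  open import Algebra.Bundles using (CommutativeRing)
  open import Relation.Binary.PropositionalEquality
  open CubicForm +-*-rawSemiring

  Cpoly+16≡Φ : ∀ v x → Cpoly v x + cst 16 ≡ Φ v (cst 2 * x - v)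
  Cpoly+16≡Φ v x = solve 2 (λ v x →
    con (cst 8) :* v :* (x :* x :* x) :- con (cst 8) :* (v :* v) :* (x :* x)
      :+ con (cst 4) :* (v :* v :* v) :* x :- v :* v :* v :* v :- con (cst 16) :+ con (cst 16)
    := let c = con (cst 2) :* x :- v in v :* c :* (v :* v :+ v :* c :+ c :* c)) refl v x
    where open +-*-Solver

  Dpoly≡-Cpoly : ∀ v x → Dpoly v x ≡ - Cpoly v (- x)
  Dpoly≡-Cpoly v x = solve 2 (λ v x →
    con (cst 8) :* v :* (x :* x :* x) :+ con (cst 8) :* (v :* v) :* (x :* x)
      :+ con (cst 4) :* (v :* v :* v) :* x :+ v :* v :* v :* v :+ con (cst 16)
    := :- (con (cst 8) :* v :* ((:- x) :* (:- x) :* (:- x))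
           :- con (cst 8) :* (v :* v) :* ((:- x) :* (:- x))
           :+ con (cst 4) :* (v :* v :* v) :* (:- x) :- v :* v :* v :* v :- con (cst 16))) refl v x
    where open +-*-Solver

  Φ≢16 : ∀ b c → Φ b c ≢ cst 16
  Φ≢16 b@(mkℚ _ _ _) c@(mkℚ _ _ _) Φ≡16 =
    Integers.Φ≢⁴ (ℚᵘ.↥ u ℤ.* ℚᵘ.↧ w) (ℚᵘ.↥ w ℤ.* ℚᵘ.↧ u) (+ 2 ℤ.* N)
      (trans (UnnormalisedRationals.Φ≃16⇒Φℤ≡16N⁴ u w Φᵘ≃16) (16*⁴≡[2*]⁴ N))
    where
    open CommutativeRing ℚᵘ.+-*-commutativeRing using (semiring)
    u = toℚᵘ b
    w = toℚᵘ c
    N = ℚᵘ.↧ u ℤ.* ℚᵘ.↧ w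
    Φᵘ≃16 : UnnormalisedRationals.Φ u w ℚᵘ.≃ + 16 ℚᵘ./ 1
    Φᵘ≃16 = ℚᵘ.≃-trans
      (ℚᵘ.≃-sym (Φ-homo +-*-rawSemiring semiring toℚᵘ toℚᵘ-homo-+ toℚᵘ-homo-* b c))
      (toℚᵘ-cong Φ≡16)
    16*⁴≡[2*]⁴ : ∀ n → + 16 ℤ.* (n ℤ.* n ℤ.* (n ℤ.* n))
                       ≡ (+ 2 ℤ.* n) ℤ.* (+ 2 ℤ.* n) ℤ.* ((+ 2 ℤ.* n) ℤ.* (+ 2 ℤ.* n))
    16*⁴≡[2*]⁴ = solve-∀

lemma4p5 : ((v x : ℚ) → ¬ (Cpoly v x ≡ 0ℚ)) × ((v x : ℚ) → ¬ (Dpoly v x ≡ 0ℚ))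
lemma4p5 = C-empty , D-empty
  where
  open Rationals using (Φ≢16; Cpoly+16≡Φ; Dpoly≡-Cpoly)
  C-empty : (v x : ℚ) → ¬ (Cpoly v x ≡ 0ℚ)
  C-empty v x C≡0 =
    Φ≢16 v (cst 2 ℚ.* x ℚ.- v) (trans (sym (Cpoly+16≡Φ v x)) (cong (ℚ._+ cst 16) C≡0))
  D-empty : (v x : ℚ) → ¬ (Dpoly v x ≡ 0ℚ)
  D-empty v x D≡0 = C-empty v (ℚ.- x) (neg-injective (trans (sym (Dpoly≡-Cpoly v x)) D≡0))
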